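{- Let $A$ be a balanced parenthesis sequence inducing the ordered matching $M$. Then $(A)$ is a balanced parenthesis sequence; let $M'$ be the ordered matching it induces. Then $$r_<(M', K_3) \leq r_<(M, K_3) + |M'| + 1,$$ where $|M'|$ denotes the number of vertices of $M'$.
   Context: An ordered graph on $n$ vertices is a graph whose vertex set is $\{1,\dots,n\}$ with its natural order; an ordered matching is one in which every vertex has degree exactly $1$ (the empty matching on $0$ vertices is allowed). A balanced parenthesis sequence is a finite (possibly empty) string of symbols "(" and ")" that is correctly matched; one of length $2m$ induces the ordered matching on $\{1,\dots,2m\}$ whose edges are the pairs of positions $\{i,j\}$ holding matched parentheses. A copy of an ordered graph $G$ on $\{1,\dots,m\}$ inside an edge-colored ordered complete graph on $\{1,\dots,N\}$ is an increasing map from $\{1,\dots,m\}$ to $\{1,\dots,N\}$ sending every edge of $G$ to an edge; it is red (resp. blue) if all image edges are red (resp. blue). For ordered graphs $G,H$, $r_<(G,H)$ is the smallest nonnegative integer $N$ such that every red/blue coloring of the edges of the ordered complete graph on $\{1,\dots,N\}$ contains a red copy of $G$ or a blue copy of $H$. $K_3$ is the triangle. -}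

module Defs where

open import Data.Nat using (ℕ; zero; suc; _+_; _∸_; _<_)
open import Data.Fin using (Fin; toℕ)
open import Data.List using (List; []; _∷_; _++_; length; lookup; take; drop)
open import Data.Bool using (Bool; true; false)
open import Data.Product using (Σ; _×_; _,_)
open import Data.Sum using (_⊎_)
open import Relation.Binary.PropositionalEquality using (_≡_)
open import Relation.Nullary using (¬_)

data Paren : Set where
  op cl : Paren

data Balanced : List Paren → Set where
  bal-nil  : Balanced []
  bal-cons : ∀ {A B} → Balanced A → Balanced B → Balanced ((op ∷ A) ++ (cl ∷ B))

wrap : List Paren → List Paren
wrap A = op ∷ A ++ (cl ∷ [])

-- Ordered graphs on {1..n} (here Fin n with its natural order).
-- Edge i j is only meaningful / required for toℕ i < toℕ j.
record OrdGraph : Set₁ where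
  field
    size : ℕ
    Edge : Fin size → Fin size → Set
open OrdGraph public

Matched : (s : List Paren) → Fin (length s) → Fin (length s) → Set
Matched s i j =
  toℕ i < toℕ j × lookup s i ≡ op × lookup s j ≡ cl ×
  Balanced (take (toℕ j ∸ suc (toℕ i)) (drop (suc (toℕ i)) s))

inducedMatching : List Paren → OrdGraph
inducedMatching s = record { size = length s ; Edge = Matched s }

K3 : OrdGraph
K3 = record { size = 3 ; Edge = λ i j → toℕ i < toℕ j }

-- Red/blue colourings of the ordered complete graph on N vertices:
-- the colour of the edge {a,b} with a < b is c a b (true = red, false = blue).
Colouring : ℕ → Set
Colouring N = Fin N → Fin N → Bool

StrictlyIncreasing : ∀ {m N} → (Fin m → Fin N) → Set
StrictlyIncreasing {m} f = ∀ (i j : Fin m) → toℕ i < toℕ j → toℕ (f i) < toℕ (f j)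

MonoCopy : (G : OrdGraph) → ∀ {N} → Colouring N → Bool → Set
MonoCopy G {N} c b = Σ (Fin (size G) → Fin N) λ f →
  StrictlyIncreasing f ×
  (∀ (i j : Fin (size G)) → toℕ i < toℕ j → Edge G i j → c (f i) (f j) ≡ b)

Arrows : OrdGraph → OrdGraph → ℕ → Set
Arrows G H N = ∀ (c : Colouring N) → MonoCopy G c true ⊎ MonoCopy H c false

IsOrdRamsey : OrdGraph → OrdGraph → ℕ → Set
IsOrdRamsey G H N = Arrows G H N × (∀ k → k < N → ¬ Arrows G H k)

-- The Ramsey part is proved for an arbitrary pair of ordered graphs G, G'
-- where G' "frames" G: G' has two more vertices, and each edge of G' either
-- starts at the first vertex or is an edge of G shifted one place to the
-- right.  Colour K_{1+N+|G'|} with N = r<(G,K3) and look at the first vertex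
-- (the apex) and its |G'| + N later neighbours.  By an ordered pigeonhole
-- principle the apex has |G'| blue or N + 1 red later neighbours.
--   * |G'| blue neighbours: a blue edge among them closes a blue triangle
--     with the apex; otherwise they span a red clique, holding a red G'.
--   * N + 1 red neighbours: the first N contain a red G or a blue K3; a red
--     G together with the apex and the last red neighbour is a red G'.
-- The combinatorics of words then shows that (A) frames A for balanced A:
-- the outer pair starts at the first position, and no opening parenthesis
-- of A can be matched with the final ')', since the stack depth of a
-- balanced word returns to where it started.

module Submission where

open import Defs
open import Data.Nat using (ℕ; zero; suc; _+_; _≤_; _<_; _∸_; z≤n; s≤s; s≤s⁻¹; s<s⁻¹; _<?_)
open import Data.Nat.Properties
  using (≤-refl; ≤-reflexive; ≤-trans; <-trans; <-≤-trans; <⇒≤; ≮⇒≥; ≤∧≢⇒<; ∸-monoˡ-≤; +-comm; +-suc; m<1+n⇒m≤n)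
open import Data.List using (List; []; _∷_; _++_; length; lookup; take; drop)
open import Data.List.Properties using (length-++; length-drop; take-all)
open import Data.Fin using (Fin; zero; suc; toℕ; inject₁; fromℕ; fromℕ<)
open import Data.Fin.Properties using (toℕ-inject₁; toℕ-fromℕ; toℕ-fromℕ<; fromℕ<-toℕ; toℕ<n; any?)
import Data.Vec.Functional as Vec
open import Data.Bool using (Bool; true; false)
open import Data.Bool.Properties using () renaming (_≟_ to _≟ᵇ_)
open import Data.Maybe using (Maybe; just; nothing; _>>=_)
open import Data.Product using (Σ; ∃; _×_; _,_; proj₁)
open import Data.Sum using (_⊎_; inj₁; inj₂)
import Data.Sum as Sum
open import Relation.Nullary using (¬_; yes; no; contradiction)
open import Relation.Nullary.Decidable using (_×-dec_)
open import Relation.Binary.PropositionalEquality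
  using (_≡_; refl; sym; trans; cong; subst; subst₂; module ≡-Reasoning)

-- Nesting depth after reading a word from depth d; nothing when some ')'
-- has no partner.
depth : ℕ → List Paren → Maybe ℕ
depth d []             = just d
depth d (op ∷ s)       = depth (suc d) s
depth zero (cl ∷ s)    = nothing
depth (suc d) (cl ∷ s) = depth d s

depth-++ : ∀ d xs ys → depth d (xs ++ ys) ≡ (depth d xs >>= λ e → depth e ys)
depth-++ d       []        ys = refl
depth-++ d       (op ∷ xs) ys = depth-++ (suc d) xs ys
depth-++ zero    (cl ∷ xs) ys = refl
depth-++ (suc d) (cl ∷ xs) ys = depth-++ d xs ys

balanced-depth : ∀ {s} → Balanced s → ∀ d → depth d s ≡ just d
balanced-depth bal-nil d = refl
balanced-depth (bal-cons {A} {B} a b) d = begin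
  depth d ((op ∷ A) ++ (cl ∷ B))          ≡⟨ depth-++ (suc d) A (cl ∷ B) ⟩
  (depth (suc d) A >>= λ e → depth e (cl ∷ B)) ≡⟨ cong (_>>= λ e → depth e (cl ∷ B)) (balanced-depth a (suc d)) ⟩
  depth d B                                ≡⟨ balanced-depth b d ⟩
  just d                                   ∎
  where open ≡-Reasoning

-- What follows an opening parenthesis of a balanced word is unbalanced:
-- it would lead from depth p + 1 back to p + 1 instead of to 0.
suffix-after-open : ∀ P S → Balanced (P ++ op ∷ S) → ¬ Balanced S
suffix-after-open P S bPS bS with depth 0 P | depth-++ 0 P (op ∷ S) | balanced-depth bPS 0
... | nothing | split | whole with trans (sym split) whole
...   | ()
suffix-after-open P S bPS bS | just p | split | whole
  with trans (sym (balanced-depth bS (suc p))) (trans (sym split) whole)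
...   | ()

module _ {X : Set} where

  between : List X → ℕ → ℕ → List X
  between s i j = take (j ∸ suc i) (drop (suc i) s)

  take-++ˡ : ∀ n (xs ys : List X) → n ≤ length xs → take n (xs ++ ys) ≡ take n xs
  take-++ˡ zero    xs       ys _         = refl
  take-++ˡ (suc n) (x ∷ xs) ys (s≤s n≤) = cong (x ∷_) (take-++ˡ n xs ys n≤)

  drop-++ˡ : ∀ n (xs ys : List X) → n ≤ length xs → drop n (xs ++ ys) ≡ drop n xs ++ ys
  drop-++ˡ zero    xs       ys _         = refl
  drop-++ˡ (suc n) (x ∷ xs) ys (s≤s n≤) = drop-++ˡ n xs ys n≤

  lookup-++ˡ : ∀ (xs ys : List X) (k : Fin (length (xs ++ ys))) (k< : toℕ k < length xs) →
    lookup (xs ++ ys) k ≡ lookup xs (fromℕ< k<)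
  lookup-++ˡ (x ∷ xs) ys zero    _   = refl
  lookup-++ˡ (x ∷ xs) ys (suc k) k< = lookup-++ˡ xs ys k (s<s⁻¹ k<)

  split-at : ∀ (xs : List X) (k : Fin (length xs)) →
    xs ≡ take (toℕ k) xs ++ lookup xs k ∷ drop (suc (toℕ k)) xs
  split-at (x ∷ xs) zero    = refl
  split-at (x ∷ xs) (suc k) = cong (x ∷_) (split-at xs k)

  between-++ : ∀ (xs ys : List X) {i j} → i < j → j ≤ length xs →
    between (xs ++ ys) i j ≡ between xs i j
  between-++ xs ys {i} {j} i<j j≤ = begin
    take (j ∸ suc i) (drop (suc i) (xs ++ ys))   ≡⟨ cong (take (j ∸ suc i)) (drop-++ˡ (suc i) xs ys (≤-trans i<j j≤)) ⟩
    take (j ∸ suc i) (drop (suc i) xs ++ ys)     ≡⟨ take-++ˡ (j ∸ suc i) (drop (suc i) xs) ys fits ⟩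
    take (j ∸ suc i) (drop (suc i) xs)           ∎
    where
    open ≡-Reasoning
    fits : j ∸ suc i ≤ length (drop (suc i) xs)
    fits = subst (j ∸ suc i ≤_) (sym (length-drop (suc i) xs)) (∸-monoˡ-≤ (suc i) j≤)

  between-end : ∀ (xs ys : List X) {i} → i < length xs →
    between (xs ++ ys) i (length xs) ≡ drop (suc i) xs
  between-end xs ys {i} i< =
    trans (between-++ xs ys i< ≤-refl)
          (take-all (length xs ∸ suc i) (drop (suc i) xs) (≤-reflexive (length-drop (suc i) xs)))

open-not-closed-at-end : ∀ {xs} → Balanced xs → (k : Fin (length xs)) →
  lookup xs k ≡ op → ¬ Balanced (drop (suc (toℕ k)) xs)
open-not-closed-at-end {xs} bal k k-op =
  suffix-after-open (take (toℕ k) xs) (drop (suc (toℕ k)) xs) cut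
  where
  cut : Balanced (take (toℕ k) xs ++ op ∷ drop (suc (toℕ k)) xs)
  cut = subst (λ p → Balanced (take (toℕ k) xs ++ p ∷ drop (suc (toℕ k)) xs)) k-op
          (subst Balanced (split-at xs k) bal)

unmatched-after-balanced : ∀ xs ys → Balanced xs → (a b : Fin (length (xs ++ ys))) →
  toℕ b ≡ length xs → ¬ Matched (xs ++ ys) a b
unmatched-after-balanced xs ys bal a b b≡ (a<b , a-op , _ , inside) =
  open-not-closed-at-end bal a′ a′-op rest
  where
  a< : toℕ a < length xs
  a< = subst (toℕ a <_) b≡ a<b
  a′ : Fin (length xs)
  a′ = fromℕ< a<
  a′-op : lookup xs a′ ≡ op
  a′-op = trans (sym (lookup-++ˡ xs ys a a<)) a-op
  rest : Balanced (drop (suc (toℕ a′)) xs)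
  rest = subst (λ i → Balanced (drop (suc i) xs)) (sym (toℕ-fromℕ< a<))
           (subst Balanced (between-end xs ys a<)
             (subst (λ j → Balanced (between (xs ++ ys) (toℕ a) j)) b≡ inside))

matched-prefix : ∀ xs ys (a b : Fin (length (xs ++ ys))) → toℕ b < length xs →
  Matched (xs ++ ys) a b →
  Σ (Fin (length xs)) λ a′ → Σ (Fin (length xs)) λ b′ →
    toℕ a ≡ toℕ a′ × toℕ b ≡ toℕ b′ × Matched xs a′ b′
matched-prefix xs ys a b b< (a<b , a-op , b-cl , inside) =
  fromℕ< a< , fromℕ< b< , a≡ , b≡ ,
  subst₂ _<_ a≡ b≡ a<b ,
  trans (sym (lookup-++ˡ xs ys a a<)) a-op ,
  trans (sym (lookup-++ˡ xs ys b b<)) b-cl ,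
  subst₂ (λ i j → Balanced (between xs i j)) a≡ b≡
    (subst Balanced (between-++ xs ys a<b (<⇒≤ b<)) inside)
  where
  a< : toℕ a < length xs
  a< = <-trans a<b b<
  a≡ : toℕ a ≡ toℕ (fromℕ< a<)
  a≡ = sym (toℕ-fromℕ< a<)
  b≡ : toℕ b ≡ toℕ (fromℕ< b<)
  b≡ = sym (toℕ-fromℕ< b<)

ShiftedEdge : (G G' : OrdGraph) → Fin (size G') → Fin (size G') → Set
ShiftedEdge G G' i j = Σ (Fin (size G)) λ a → Σ (Fin (size G)) λ b →
  toℕ i ≡ suc (toℕ a) × toℕ j ≡ suc (toℕ b) × Edge G a b

record Frames (G G' : OrdGraph) : Set where
  field
    size-frame : size G' ≡ suc (suc (size G))
    edge-frame : ∀ i j → toℕ i < toℕ j → Edge G' i j → toℕ i ≡ 0 ⊎ ShiftedEdge G G' i j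

wrap-frames : ∀ {A} → Balanced A → Frames (inducedMatching A) (inducedMatching (wrap A))
wrap-frames {A} bal = record { size-frame = cong suc length-A+cl ; edge-frame = edge }
  where
  length-A+cl : length (A ++ cl ∷ []) ≡ suc (length A)
  length-A+cl = trans (length-++ A) (+-comm (length A) 1)

  edge : ∀ i j → toℕ i < toℕ j → Matched (wrap A) i j →
    toℕ i ≡ 0 ⊎ ShiftedEdge (inducedMatching A) (inducedMatching (wrap A)) i j
  edge zero    j       _         _ = inj₁ refl
  edge (suc a) (suc b) (s≤s a<b) (_ , a-op , b-cl , inside)
    with matched-prefix A (cl ∷ []) a b b<A inner
    where
    inner : Matched (A ++ cl ∷ []) a b
    inner = a<b , a-op , b-cl , inside
    b≤A : toℕ b ≤ length A
    b≤A = m<1+n⇒m≤n (subst (toℕ b <_) length-A+cl (toℕ<n b))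
    b<A : toℕ b < length A
    b<A = ≤∧≢⇒< b≤A λ b≡A → unmatched-after-balanced A (cl ∷ []) bal a b b≡A inner
  ... | a′ , b′ , a≡ , b≡ , matched = inj₂ (a′ , b′ , cong suc a≡ , cong suc b≡ , matched)

Choice : ∀ {n} → (Fin n → Bool) → Bool → ℕ → Set
Choice {n} f b m = Σ (Fin m → Fin n) λ g → StrictlyIncreasing g × (∀ k → f (g k) ≡ b)

module _ {n} (f : Fin (suc n) → Bool) {b : Bool} where

  choice-skip : ∀ {m} → Choice (λ k → f (suc k)) b m → Choice f b m
  choice-skip (g , g-inc , g-val) = (λ k → suc (g k)) , (λ i j i<j → s≤s (g-inc i j i<j)) , g-val

  choice-cons : ∀ {m} → f zero ≡ b → Choice (λ k → f (suc k)) b m → Choice f b (suc m)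
  choice-cons {m} f0 (g , g-inc , g-val) = g′ , g′-inc , g′-val
    where
    g′ : Fin (suc m) → Fin (suc n)
    g′ zero    = zero
    g′ (suc k) = suc (g k)
    g′-inc : StrictlyIncreasing g′
    g′-inc zero    (suc j) _   = s≤s z≤n
    g′-inc (suc i) (suc j) i<j = s≤s (g-inc i j (s<s⁻¹ i<j))
    g′-val : ∀ k → f (g′ k) ≡ b
    g′-val zero    = f0
    g′-val (suc k) = g-val k

choice-empty : ∀ {n} (f : Fin n → Bool) {b} → Choice f b 0
choice-empty f = (λ ()) , (λ ()) , (λ ())

pigeonhole : ∀ {n} (f : Fin n → Bool) r s → r + s ≤ suc n → Choice f true r ⊎ Choice f false s
pigeonhole f zero    s    _ = inj₁ (choice-empty f)
pigeonhole f (suc r) zero _ = inj₂ (choice-empty f)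
pigeonhole {zero} f (suc r) (suc s) (s≤s r+s≤0) with subst (_≤ 0) (+-suc r s) r+s≤0
... | ()
pigeonhole {suc n} f (suc r) (suc s) (s≤s r+s≤) with f zero in f0
... | true with pigeonhole (λ k → f (suc k)) r (suc s) r+s≤
...   | inj₁ trues  = inj₁ (choice-cons f f0 trues)
...   | inj₂ falses = inj₂ (choice-skip f falses)
pigeonhole {suc n} f (suc r) (suc s) (s≤s r+s≤) | false
  with pigeonhole (λ k → f (suc k)) (suc r) s (subst (_≤ suc n) (+-suc r s) r+s≤)
...   | inj₁ trues  = inj₁ (choice-skip f trues)
...   | inj₂ falses = inj₂ (choice-cons f f0 falses)

restrict : ∀ {m N} → Colouring N → (Fin m → Fin N) → Colouring m
restrict c g a b = c (g a) (g b)

copy-lift : ∀ {H m N} (c : Colouring N) (g : Fin m → Fin N) {b} →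
  StrictlyIncreasing g → MonoCopy H (restrict c g) b → MonoCopy H c b
copy-lift c g g-inc (e , e-inc , e-col) =
  (λ k → g (e k)) , (λ i j i<j → g-inc _ _ (e-inc i j i<j)) , e-col

Clique : ∀ {m N} → Colouring N → Bool → (Fin m → Fin N) → Set
Clique c b V = StrictlyIncreasing V × (∀ i j → toℕ i < toℕ j → c (V i) (V j) ≡ b)

clique-copy : ∀ H {N} (c : Colouring N) {b} {V : Fin (size H) → Fin N} → Clique c b V → MonoCopy H c b
clique-copy H c {V = V} (V-inc , V-col) = V , V-inc , λ i j i<j _ → V-col i j i<j

cone-clique : ∀ {m N} (c : Colouring N) {b} (x : Fin N) {V : Fin m → Fin N} →
  (∀ k → toℕ x < toℕ (V k)) → (∀ k → c x (V k) ≡ b) → Clique c b V → Clique c b (x Vec.∷ V)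
cone-clique c x x<V x-col (V-inc , V-col) = inc , col
  where
  inc : StrictlyIncreasing (x Vec.∷ _)
  inc zero    (suc j) _   = x<V j
  inc (suc i) (suc j) i<j = V-inc i j (s<s⁻¹ i<j)
  col : ∀ i j → toℕ i < toℕ j → _ ≡ _
  col zero    (suc j) _   = x-col j
  col (suc i) (suc j) i<j = V-col i j (s<s⁻¹ i<j)

triangle : ∀ {N} (c : Colouring N) {b} {x y z : Fin N} → toℕ x < toℕ y → toℕ y < toℕ z →
  c x y ≡ b → c x z ≡ b → c y z ≡ b → MonoCopy K3 c b
triangle c {b} {x} {y} {z} x<y y<z xy xz yz =
  clique-copy K3 c (cone-clique c x x<yz x-yz (cone-clique c y (λ { zero → y<z }) (λ { zero → yz }) point))
  where
  point : Clique c b (z Vec.∷ Vec.[])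
  point = (λ { zero zero () }) , (λ { zero zero () })
  x<yz : ∀ k → toℕ x < toℕ ((y Vec.∷ z Vec.∷ Vec.[]) k)
  x<yz zero       = x<y
  x<yz (suc zero) = <-trans x<y y<z
  x-yz : ∀ k → c x ((y Vec.∷ z Vec.∷ Vec.[]) k) ≡ b
  x-yz zero       = xy
  x-yz (suc zero) = xz

red-or-blue-pair : ∀ {m N} (c : Colouring N) (V : Fin m → Fin N) →
  (∀ i j → toℕ i < toℕ j → c (V i) (V j) ≡ true) ⊎
  ∃ λ i → ∃ λ j → toℕ i < toℕ j × c (V i) (V j) ≡ false
red-or-blue-pair c V with any? (λ i → any? (λ j → (toℕ i <? toℕ j) ×-dec (c (V i) (V j) ≟ᵇ false)))
... | yes blue-pair = inj₂ blue-pair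
... | no no-blue-pair = inj₁ red
  where
  red : ∀ i j → toℕ i < toℕ j → c (V i) (V j) ≡ true
  red i j i<j with c (V i) (V j) in col
  ... | true  = refl
  ... | false = contradiction (i , j , i<j , col) no-blue-pair

apex-colour : ∀ {M} → Colouring (suc M) → Fin M → Bool
apex-colour c k = c zero (suc k)

blue-apex : ∀ {M} (c : Colouring (suc M)) H →
  Choice (apex-colour c) false (size H) → MonoCopy H c true ⊎ MonoCopy K3 c false
blue-apex c H (g , g-inc , g-blue) with red-or-blue-pair c (λ k → suc (g k))
... | inj₁ red = inj₁ (clique-copy H c ((λ i j i<j → s≤s (g-inc i j i<j)) , red))
... | inj₂ (i , j , i<j , blue) =
  inj₂ (triangle c (s≤s z≤n) (s≤s (g-inc i j i<j)) (g-blue i) (g-blue j) blue)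

-- Given red neighbours h 0 < … < h N of the apex and a red copy e of G on
-- the first N of them, the apex, e and the last neighbour h N form a red G'.
module FramedCopy {G G' : OrdGraph} (frames : Frames G G') {N M : ℕ} (c : Colouring (suc M))
  (h : Fin (suc N) → Fin M) (h-inc : StrictlyIncreasing h) (h-red : ∀ k → apex-colour c (h k) ≡ true)
  (e : Fin (size G) → Fin N) (e-inc : StrictlyIncreasing e)
  (e-red : ∀ a b → toℕ a < toℕ b → Edge G a b → c (suc (h (inject₁ (e a)))) (suc (h (inject₁ (e b)))) ≡ true)
  where
  open Frames frames

  -- The neighbour receiving vertex k + 1 of G'.
  slot : ℕ → Fin (suc N)
  slot k with k <? size G
  ... | yes k<G = inject₁ (e (fromℕ< k<G))
  ... | no _    = fromℕ N

  place : ℕ → Fin (suc M)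
  place zero    = zero
  place (suc k) = suc (h (slot k))

  slot-at : (a : Fin (size G)) → slot (toℕ a) ≡ inject₁ (e a)
  slot-at a with toℕ a <? size G
  ... | yes a<G = cong (λ a′ → inject₁ (e a′)) (fromℕ<-toℕ a a<G)
  ... | no a≮G  = contradiction (toℕ<n a) a≮G

  slot-mono : ∀ {k l} → k < l → l ≤ size G → toℕ (slot k) < toℕ (slot l)
  slot-mono {k} {l} k<l l≤G with k <? size G | l <? size G
  ... | yes k<G | yes l<G =
    subst₂ _<_ (sym (toℕ-inject₁ _)) (sym (toℕ-inject₁ _))
      (e-inc _ _ (subst₂ _<_ (sym (toℕ-fromℕ< k<G)) (sym (toℕ-fromℕ< l<G)) k<l))
  ... | yes k<G | no _ = subst₂ _<_ (sym (toℕ-inject₁ _)) (sym (toℕ-fromℕ N)) (toℕ<n _)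
  ... | no k≮G  | _    = contradiction (<-≤-trans k<l l≤G) k≮G

  place-mono : ∀ {k l} → k < l → l ≤ suc (size G) → toℕ (place k) < toℕ (place l)
  place-mono {zero}  {suc l} _   _   = s≤s z≤n
  place-mono {suc k} {suc l} k<l l≤ = s≤s (h-inc _ _ (slot-mono (s<s⁻¹ k<l) (s≤s⁻¹ l≤)))

  place-shifted : ∀ {i} (a : Fin (size G)) → i ≡ suc (toℕ a) → place i ≡ suc (h (inject₁ (e a)))
  place-shifted a refl = cong (λ v → suc (h v)) (slot-at a)

  copy : Fin (size G') → Fin (suc M)
  copy i = place (toℕ i)

  copy-inc : StrictlyIncreasing copy
  copy-inc i j i<j = place-mono i<j (m<1+n⇒m≤n (subst (toℕ j <_) size-frame (toℕ<n j)))

  apex-red : ∀ l → 0 < l → c zero (place l) ≡ true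
  apex-red (suc l) _ = h-red (slot l)

  -- Edges at the apex are red by the choice of h, shifted edges of G by e.
  copy-red : ∀ i j → toℕ i < toℕ j → Edge G' i j → c (copy i) (copy j) ≡ true
  copy-red i j i<j ij with edge-frame i j i<j ij
  ... | inj₁ i≡0 =
    subst (λ v → c (place v) (copy j) ≡ true) (sym i≡0) (apex-red (toℕ j) (subst (_< toℕ j) i≡0 i<j))
  ... | inj₂ (a , b , i≡ , j≡ , ab) =
    subst₂ (λ x y → c x y ≡ true) (sym (place-shifted a i≡)) (sym (place-shifted b j≡))
      (e-red a b (s<s⁻¹ (subst₂ _<_ i≡ j≡ i<j)) ab)

  framed-copy : MonoCopy G' c true
  framed-copy = copy , copy-inc , copy-red

red-apex : ∀ {G G' N M} → Frames G G' → Arrows G K3 N → (c : Colouring (suc M)) →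
  Choice (apex-colour c) true (suc N) → MonoCopy G' c true ⊎ MonoCopy K3 c false
red-apex {G} {G'} {N} {M} frames arrows c (h , h-inc , h-red) =
  Sum.map extend-red (copy-lift c first-N first-N-inc) (arrows (restrict c first-N))
  where
  first-N : Fin N → Fin (suc M)
  first-N k = suc (h (inject₁ k))
  first-N-inc : StrictlyIncreasing first-N
  first-N-inc i j i<j = s≤s (h-inc _ _ (subst₂ _<_ (sym (toℕ-inject₁ i)) (sym (toℕ-inject₁ j)) i<j))
  extend-red : MonoCopy G (restrict c first-N) true → MonoCopy G' c true
  extend-red (e , e-inc , e-red) = FramedCopy.framed-copy frames c h h-inc h-red e e-inc e-red

frame-arrows : ∀ {G G' N} → Frames G G' → Arrows G K3 N → Arrows G' K3 (suc (N + size G'))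
frame-arrows {G' = G'} {N} frames arrows c with pigeonhole (apex-colour c) (suc N) (size G') ≤-refl
... | inj₁ reds  = red-apex frames arrows c reds
... | inj₂ blues = blue-apex c G' blues

ramsey-minimal : ∀ {G H N M} → IsOrdRamsey G H N → Arrows G H M → N ≤ M
ramsey-minimal (_ , below) arrows = ≮⇒≥ λ M<N → below _ M<N arrows

lemma6 : (A : List Paren) → Balanced A →
    Balanced (wrap A) ×
    (∀ (N N' : ℕ) → IsOrdRamsey (inducedMatching A) K3 N →
      IsOrdRamsey (inducedMatching (wrap A)) K3 N' →
      N' ≤ N + length (wrap A) + 1)
lemma6 A bal = bal-cons bal bal-nil , bound
  where
  bound : ∀ N N' → IsOrdRamsey (inducedMatching A) K3 N →
    IsOrdRamsey (inducedMatching (wrap A)) K3 N' → N' ≤ N + length (wrap A) + 1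
  bound N N' ramsey ramsey′ =
    subst (N' ≤_) (+-comm 1 (N + length (wrap A)))
      (ramsey-minimal ramsey′ (frame-arrows (wrap-frames bal) (proj₁ ramsey)))
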